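{- Let $t\geqslant0$ and $r\geqslant0$ be integers, and let $H$ be a graph with a proper $t$-colouring such that for every vertex $v$ of $H$, the neighbours of $v$ receive at most $r$ distinct colours. Then $\chi(H)\leqslant\lfloor\frac{tr}{r+1}\rfloor+1$.
   Context: Graphs are finite and loopless (parallel edges allowed). A $t$-colouring is a map $V(H)\to\{1,\ldots,t\}$ giving adjacent vertices different colours; $\chi(H)$ is the chromatic number. -}

module Defs where

open import Data.Nat using (ℕ; _≤_)
open import Data.Fin using (Fin)
open import Data.Fin.Subset using (Subset; _∈_; ∣_∣)
open import Data.Product using (∃; _×_)
open import Relation.Nullary using (¬_)
open import Relation.Binary.PropositionalEquality using (_≡_)
open import Level using (0ℓ; suc)

-- A finite loopless graph on vertex set Fin n. Parallel edges are irrelevant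
-- for colouring, so only the (symmetric, irreflexive) adjacency relation is kept.
record Graph : Set₁ where
  field
    n     : ℕ
    Adj   : Fin n → Fin n → Set
    sym   : ∀ {u v} → Adj u v → Adj v u
    loopless : ∀ {v} → ¬ Adj v v

open Graph public

IsColouring : (H : Graph) (t : ℕ) → (Fin (n H) → Fin t) → Set
IsColouring H t c = ∀ u v → Adj H u v → ¬ (c u ≡ c v)

Colourable : Graph → ℕ → Set
Colourable H k = ∃ λ (c : Fin (n H) → Fin k) → IsColouring H k c

χ≤ : Graph → ℕ → Set
χ≤ H k = Colourable H k

-- The neighbours of v receive at most r distinct colours under c:
-- the set of colours used on N(v) has at most r elements, i.e. it is
-- contained in some set of colours of size at most r.
NbhdColoursAtMost : (H : Graph) {t : ℕ} → (Fin (n H) → Fin t) → ℕ → Fin (n H) → Set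
NbhdColoursAtMost H {t} c r v =
  ∃ λ (S : Subset t) → (∣ S ∣ ≤ r) × (∀ u → Adj H v u → c u ∈ S)

module Submission where

-- Put k = ⌊tr/(r+1)⌋, q = k + 1 and m = t ∸ q.  Vertices of colour < q keep
-- their colour.  The remaining m colour classes are recoloured into the palette
-- {0, …, k}: the d-th high class receives the block B_d = {dr, …, dr + r - 1},
-- and all high classes share one extra colour mr.  The arithmetic fact
-- mr < q (`highBlocksFit`) puts all these colours in the palette.  A high vertex
-- v takes a colour of B_d ∪ {mr} that is not seen on its neighbourhood; one
-- exists since at most r colours are seen there, and mr is only used when B_d is
-- entirely seen.  Properness then follows from a pigeonhole principle for finite
-- subsets (`injective⇒≤∣S∣`): a neighbourhood that sees all of B_d sees nothing
-- else, so two adjacent vertices can never both end up on mr.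

open import Defs
open import Data.Nat using (ℕ; suc; _*_; _+_; _/_)
open import Data.Fin using (Fin)

open import Data.Nat using (zero; _≤_; _<_; _∸_; z≤n; s≤s; _<?_; NonZero)
open import Data.Nat.Properties
  using (≤-trans; <-trans; <-≤-trans; <-cmp; <⇒≢; ≮⇒≥; n≮n; m≤m+n; +-comm; *-suc;
         +-monoˡ-<; +-monoʳ-<; *-monoˡ-≤; +-cancelˡ-≡; *-distribʳ-∸;
         m<n+o⇒m∸n<o; ∸-monoˡ-<; ∸-cancelʳ-≡; module ≤-Reasoning)
open import Data.Nat.DivMod using (_%_; m≡m%n+[m/n]*n; m%n<n)
open import Data.Fin using (zero; suc; toℕ; fromℕ<)
open import Data.Fin.Properties
  using (toℕ<n; toℕ-injective; toℕ-fromℕ<; suc-injective; 0≢1+n; any?)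
open import Data.Fin.Subset using (Subset; _∈_; ∣_∣; _-_)
open import Data.Fin.Subset.Properties using (_∈?_; x∈p⇒∣p-x∣<∣p∣; x∈p∧x≢y⇒x∈p-y)
open import Data.Product using (∃; _×_; _,_; proj₁; proj₂)
open import Function using (_∘_)
open import Function.Definitions using (Injective)
open import Relation.Binary.Definitions using (tri<; tri≈; tri>)
open import Relation.Binary.PropositionalEquality
  using (_≡_; _≢_; refl; trans; cong; subst; ≢-sym) renaming (sym to ≡-sym)
open import Relation.Nullary using (¬_; Dec; yes; no; ¬?; contradiction)
open import Relation.Nullary.Decidable using (decidable-stable; map′)

injective⇒≤∣S∣ : ∀ {t k} {S : Subset t} (g : Fin k → Fin t) →
                 Injective _≡_ _≡_ g → (∀ i → g i ∈ S) → k ≤ ∣ S ∣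
injective⇒≤∣S∣ {k = zero} g inj mem = z≤n
injective⇒≤∣S∣ {k = suc k} {S} g inj mem = ≤-trans (s≤s rest) (x∈p⇒∣p-x∣<∣p∣ (mem zero))
  where
  rest : k ≤ ∣ S - g zero ∣
  rest = injective⇒≤∣S∣ (g ∘ suc) (suc-injective ∘ inj)
           (λ i → x∈p∧x≢y⇒x∈p-y (mem (suc i)) (λ e → 0≢1+n (inj (≡-sym e))))

-- The recolouring computes with colours as natural numbers, so we need
-- membership of a natural number in a set of colours Fin t.
infix 4 _∈ℕ_ _∈ℕ?_

_∈ℕ_ : ∀ {t} → ℕ → Subset t → Set
x ∈ℕ S = ∃ λ y → toℕ y ≡ x × y ∈ S

_∈ℕ?_ : ∀ {t} (x : ℕ) (S : Subset t) → Dec (x ∈ℕ S)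
_∈ℕ?_ {t} x S with x <? t
... | no x≮t = no λ { (y , refl , _) → x≮t (toℕ<n y) }
... | yes x<t = map′ (λ y∈S → fromℕ< x<t , toℕ-fromℕ< x<t , y∈S) fromWitness (fromℕ< x<t ∈? S)
  where
  fromWitness : x ∈ℕ S → fromℕ< x<t ∈ S
  fromWitness (y , refl , y∈S) =
    subst (_∈ S) (toℕ-injective (≡-sym (toℕ-fromℕ< x<t))) y∈S

injectiveℕ⇒≤∣S∣ : ∀ {t k} {S : Subset t} (g : Fin k → ℕ) →
                  Injective _≡_ _≡_ g → (∀ i → g i ∈ℕ S) → k ≤ ∣ S ∣
injectiveℕ⇒≤∣S∣ g inj mem = injective⇒≤∣S∣ (proj₁ ∘ mem) inj′ (proj₂ ∘ proj₂ ∘ mem)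
  where
  inj′ : Injective _≡_ _≡_ (proj₁ ∘ mem)
  inj′ {i} {j} e = inj (trans (≡-sym (proj₁ (proj₂ (mem i))))
                        (trans (cong toℕ e) (proj₁ (proj₂ (mem j)))))

a<[1+a/n]*n : ∀ a n .{{_ : NonZero n}} → a < suc (a / n) * n
a<[1+a/n]*n a n = begin-strict
  a                 ≡⟨ m≡m%n+[m/n]*n a n ⟩
  a % n + a / n * n <⟨ +-monoˡ-< (a / n * n) (m%n<n a n) ⟩
  suc (a / n) * n   ∎
  where open ≤-Reasoning

highBlocksFit : ∀ t r → (t ∸ suc (t * r / suc r)) * r < suc (t * r / suc r)
highBlocksFit t r = begin-strict
  (t ∸ q) * r   ≡⟨ *-distribʳ-∸ r t q ⟩
  t * r ∸ q * r <⟨ m<n+o⇒m∸n<o (t * r) (q * r) tr<qr+q ⟩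
  q             ∎
  where
  open ≤-Reasoning
  q : ℕ
  q = suc (t * r / suc r)
  tr<qr+q : t * r < q * r + q
  tr<qr+q = subst (t * r <_) (trans (*-suc q r) (+-comm q (q * r)))
                  (a<[1+a/n]*n (t * r) (suc r))

module Blocks (r : ℕ) where

  block : ℕ → Fin r → ℕ
  block d j = d * r + toℕ j

  block<start : ∀ {d e} → d < e → (i : Fin r) → block d i < e * r
  block<start {d} {e} d<e i = begin-strict
    d * r + toℕ i <⟨ +-monoʳ-< (d * r) (toℕ<n i) ⟩
    d * r + r     ≡⟨ +-comm (d * r) r ⟩
    suc d * r     ≤⟨ *-monoˡ-≤ r d<e ⟩
    e * r         ∎
    where open ≤-Reasoning

  block-injective : ∀ d → Injective _≡_ _≡_ (block d)
  block-injective d e = toℕ-injective (+-cancelˡ-≡ (d * r) _ _ e)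

  block-disjoint : ∀ {d e} → d ≢ e → ∀ i j → block d i ≢ block e j
  block-disjoint {d} {e} d≢e i j with <-cmp d e
  ... | tri< d<e _ _ = <⇒≢ (≤-trans (block<start d<e i) (m≤m+n (e * r) (toℕ j)))
  ... | tri≈ _ d≡e _ = λ _ → d≢e d≡e
  ... | tri> _ _ e<d = ≢-sym (<⇒≢ (≤-trans (block<start e<d j) (m≤m+n (d * r) (toℕ i))))

  -- A set of at most r colours containing a whole block contains no colour
  -- above that block: together they would be r + 1 distinct members.
  saturated : ∀ {t} {S : Subset t} → ∣ S ∣ ≤ r → ∀ d → (∀ j → block d j ∈ℕ S) →
              ∀ y → (∀ j → block d j < y) → ¬ y ∈ℕ S
  saturated {S = S} sz d full y above y∈S = n≮n r (≤-trans (injectiveℕ⇒≤∣S∣ g inj mem) sz)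
    where
    g : Fin (suc r) → ℕ
    g zero    = y
    g (suc j) = block d j
    inj : Injective _≡_ _≡_ g
    inj {zero}  {zero}  _ = refl
    inj {zero}  {suc j} e = contradiction (≡-sym e) (<⇒≢ (above j))
    inj {suc i} {zero}  e = contradiction e (<⇒≢ (above i))
    inj {suc i} {suc j} e = cong suc (block-injective d e)
    mem : ∀ i → g i ∈ℕ S
    mem zero    = y∈S
    mem (suc j) = full j

  data FreeColour {t} (S : Subset t) (d top : ℕ) : ℕ → Set where
    inBlock : (j : Fin r) → ¬ block d j ∈ℕ S → FreeColour S d top (block d j)
    atTop   : (∀ j → block d j ∈ℕ S) → FreeColour S d top top

  freeColour : ∀ {t} (S : Subset t) d top → ∃ (FreeColour S d top)
  freeColour S d top with any? (λ j → ¬? (block d j ∈ℕ? S))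
  ... | yes (j , free) = block d j , inBlock j free
  ... | no noneFree    = top , atTop λ j →
          decidable-stable (block d j ∈ℕ? S) (λ notIn → noneFree (j , notIn))

  freeColour-∉ : ∀ {t} {S : Subset t} {d top x} → ∣ S ∣ ≤ r →
                 (∀ j → block d j < top) → FreeColour S d top x → ¬ x ∈ℕ S
  freeColour-∉ sz above (inBlock j free) = free
  freeColour-∉ {d = d} {top} sz above (atTop full) = saturated sz d full top above

module Recolouring (t r : ℕ) (H : Graph) (c : Fin (n H) → Fin t)
                   (proper : IsColouring H t c)
                   (fewColours : ∀ v → NbhdColoursAtMost H c r v) where

  open Blocks r

  k q m top : ℕ
  k   = t * r / suc r
  q   = suc k       -- colours below q are kept
  m   = t ∸ q       -- number of high colour classes
  top = m * r       -- the reserve colour shared by all high classes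

  seen : Fin (n H) → Subset t
  seen v = proj₁ (fewColours v)

  ∣seen∣≤r : ∀ v → ∣ seen v ∣ ≤ r
  ∣seen∣≤r v = proj₁ (proj₂ (fewColours v))

  neighbour-seen : ∀ {v u} → Adj H v u → toℕ (c u) ∈ℕ seen v
  neighbour-seen {v} {u} vu = c u , refl , proj₂ (proj₂ (fewColours v)) u vu

  height : Fin (n H) → ℕ
  height v = toℕ (c v) ∸ q

  block<top : ∀ {v} → q ≤ toℕ (c v) → ∀ j → block (height v) j < top
  block<top {v} high = block<start (∸-monoˡ-< (toℕ<n (c v)) high)

  data Recoloured (v : Fin (n H)) : ℕ → Set where
    keep : toℕ (c v) < q → Recoloured v (toℕ (c v))
    move : q ≤ toℕ (c v) → ∀ {x} → FreeColour (seen v) (height v) top x → Recoloured v x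

  recolour : ∀ v → ∃ (Recoloured v)
  recolour v with toℕ (c v) <? q
  ... | yes low = toℕ (c v) , keep low
  ... | no  ¬low = let x , free = freeColour (seen v) (height v) top
                   in x , move (≮⇒≥ ¬low) free

  recoloured-< : ∀ {v x} → Recoloured v x → x < q
  recoloured-< (keep low)               = low
  recoloured-< (move high (inBlock j _)) = <-trans (block<top high j) (highBlocksFit t r)
  recoloured-< (move high (atTop _))     = highBlocksFit t r

  move-unseen : ∀ {v x} → q ≤ toℕ (c v) →
                FreeColour (seen v) (height v) top x → ¬ x ∈ℕ seen v
  move-unseen {v} high = freeColour-∉ (∣seen∣≤r v) (block<top high)

  recoloured-proper : ∀ {u v x y} → Adj H u v → Recoloured u x → Recoloured v y → x ≢ y
  recoloured-proper uv (keep _) (keep _) e = proper _ _ uv (toℕ-injective e)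
  recoloured-proper uv (keep _) (move hv free) e =
    move-unseen hv free (subst (_∈ℕ seen _) e (neighbour-seen (Graph.sym H uv)))
  recoloured-proper uv (move hu free) (keep _) e =
    move-unseen hu free (subst (_∈ℕ seen _) (≡-sym e) (neighbour-seen uv))
  recoloured-proper uv (move hu (inBlock i _)) (move hv (inBlock j _)) =
    block-disjoint (λ e → proper _ _ uv (toℕ-injective (∸-cancelʳ-≡ hu hv e))) i j
  recoloured-proper uv (move hu (inBlock i _)) (move hv (atTop _)) =
    <⇒≢ (block<top hu i)
  recoloured-proper uv (move hu (atTop _)) (move hv (inBlock j _)) =
    ≢-sym (<⇒≢ (block<top hv j))
  recoloured-proper {u} {v} uv (move hu (atTop _)) (move hv (atTop full)) _ =
    saturated (∣seen∣≤r v) (height v) full (toℕ (c u)) above (neighbour-seen (Graph.sym H uv))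
    where
    above : ∀ j → block (height v) j < toℕ (c u)
    above j = <-≤-trans (<-trans (block<top hv j) (highBlocksFit t r)) hu

  newColour : Fin (n H) → Fin (k + 1)
  newColour v = fromℕ< (subst (proj₁ (recolour v) <_) (+-comm 1 k)
                              (recoloured-< (proj₂ (recolour v))))

  newColour-proper : IsColouring H (k + 1) newColour
  newColour-proper u v uv e = recoloured-proper uv (proj₂ (recolour u)) (proj₂ (recolour v))
    (trans (≡-sym (toℕ-fromℕ< _)) (trans (cong toℕ e) (toℕ-fromℕ< _)))

mainTheorem12 : (t r : ℕ) (H : Graph) (c : Fin (n H) → Fin t) →
                IsColouring H t c →
                (∀ v → NbhdColoursAtMost H c r v) →
                χ≤ H ((t * r) / suc r + 1)
mainTheorem12 t r H c proper fewColours = newColour , newColour-proper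
  where open Recolouring t r H c proper fewColours
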